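{- Let $a,b\ge0$ and let $T$ be a directed spanning tree of $K_{a+1,b+1}$. Then $T$ is admissible if and only if (i) $T$ contains the edge $(v_0,w_0)$ or the edge $(w_0,v_0)$; (ii) $T^\uparrow$ and $T^\downarrow$ are planar subtrees; and (iii) the vertex sets satisfy $T^\uparrow\cap T^\downarrow=\{v_0\}$ or $T^\uparrow\cap T^\downarrow=\{w_0\}$.
   Context: $K_{a+1,b+1}$ is the complete bipartite graph with upper vertices $v_0,\dots,v_a$ and lower vertices $w_0,\dots,w_b$ and edges $v_iw_j$, drawn with the $v_i$ left to right on one line and the $w_j$ left to right on a parallel lower line, edges as straight segments; edges $v_iw_l$ and $v_kw_m$ cross iff $(i-k)(l-m)<0$. A directed spanning tree is a spanning tree with each edge given one orientation; $(p,q)$ denotes the edge directed from $p$ to $q$. $T$ is admissible if it contains none of: (1) two crossing edges both directed from upper to lower vertices; (2) two crossing edges both directed from lower to upper vertices; (3) a vertex $v_i$ with $i\ge1$ that is the head of one edge of $T$ and the tail of another; (4) a vertex $w_j$ with $j\geq1$ that is the head of one edge of $T$ and the tail of another. (These are the trees corresponding to maximal simplices of the unimodular triangulation of $P_{K_{a+1,b+1}}$ given by a quadratic Gröbner basis.) $T^\uparrow$ is the subgraph formed by the edges of $T$ directed from a lower to an upper vertex (with their endpoints), and $T^\uparrow=\{w_0\}$ if there are none; $T^\downarrow$ is formed by the edges directed from an upper to a lower vertex, and $T^\downarrow=\{v_0\}$ if there are none. A subgraph is planar if no two of its edges cross; a subtree is a connected acyclic subgraph. -}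

module Defs where

open import Data.Nat using (ℕ; suc; _≥_)
open import Data.Fin using (Fin; zero; _<_)
open import Data.Product using (_×_; _,_; Σ; ∃)
open import Data.Sum using (_⊎_)
open import Data.List using (List; []; _∷_; length; map; concatMap; mapMaybe)
open import Data.List.Membership.Propositional using (_∈_)
open import Data.List.Relation.Unary.Unique.Propositional using (Unique)
open import Data.Maybe using (Maybe; just; nothing)
open import Relation.Binary.PropositionalEquality using (_≡_; _≢_)
open import Relation.Nullary using (¬_)
open import Function.Bundles using (_⇔_)

-- K_{a+1,b+1}: upper vertices v_0..v_a, lower vertices w_0..w_b

data Vertex (a b : ℕ) : Set where
  upper : Fin (suc a) → Vertex a b
  lower : Fin (suc b) → Vertex a b

Edge : ℕ → ℕ → Set
Edge a b = Fin (suc a) × Fin (suc b)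

data DEdge (a b : ℕ) : Set where
  dn : Fin (suc a) → Fin (suc b) → DEdge a b   -- (v_i , w_j) : upper to lower
  up : Fin (suc a) → Fin (suc b) → DEdge a b   -- (w_j , v_i) : lower to upper

module _ {a b : ℕ} where

  underlying : DEdge a b → Edge a b
  underlying (dn i j) = i , j
  underlying (up i j) = i , j

  tail : DEdge a b → Vertex a b
  tail (dn i j) = upper i
  tail (up i j) = lower j

  head : DEdge a b → Vertex a b
  head (dn i j) = lower j
  head (up i j) = upper i

  -- edges v_i w_l and v_k w_m cross iff (i-k)(l-m) < 0
  Cross : Edge a b → Edge a b → Set
  Cross (i , l) (k , m) = (i < k × m < l) ⊎ (k < i × l < m)

  Joins : Edge a b → Vertex a b → Vertex a b → Set
  Joins (i , j) x y = (x ≡ upper i × y ≡ lower j) ⊎ (x ≡ lower j × y ≡ upper i)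

  data Walk (E : List (Edge a b)) : Vertex a b → Vertex a b → Set where
    stop : ∀ {x} → Walk E x x
    step : ∀ {x y z} (e : Edge a b) → e ∈ E → Joins e x y → Walk E y z → Walk E x z

  walkEdges : ∀ {E x y} → Walk E x y → List (Edge a b)
  walkEdges stop = []
  walkEdges (step e _ _ w) = e ∷ walkEdges w

  HasCycle : List (Edge a b) → Set
  HasCycle E = Σ (Vertex a b) λ x → Σ (Walk E x x) λ w →
                 (length (walkEdges w) ≥ 1) × Unique (walkEdges w)

  Acyclic : List (Edge a b) → Set
  Acyclic E = ¬ HasCycle E

  record Subgraph : Set where
    constructor mkSub
    field
      verts : List (Vertex a b)
      edges : List (Edge a b)
  open Subgraph public

  Connected : Subgraph → Set
  Connected G = ∀ x y → x ∈ verts G → y ∈ verts G → Walk (edges G) x y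

  IsSubtree : Subgraph → Set
  IsSubtree G = Connected G × Acyclic (edges G)

  Planar : Subgraph → Set
  Planar G = ∀ e e' → e ∈ edges G → e' ∈ edges G → ¬ Cross e e'

  IsDirectedSpanningTree : List (DEdge a b) → Set
  IsDirectedSpanningTree T =
    Unique (map underlying T)                    -- each edge occurs once, with one orientation
    × (∀ x y → Walk (map underlying T) x y)
    × Acyclic (map underlying T)

  IsUp IsDown : DEdge a b → Set
  IsUp d = ∃ λ i → ∃ λ j → d ≡ up i j
  IsDown d = ∃ λ i → ∃ λ j → d ≡ dn i j

  Admissible : List (DEdge a b) → Set
  Admissible T =
    (¬ ∃ λ d → ∃ λ d' → d ∈ T × d' ∈ T × IsDown d × IsDown d' × Cross (underlying d) (underlying d'))
    × (¬ ∃ λ d → ∃ λ d' → d ∈ T × d' ∈ T × IsUp d × IsUp d' × Cross (underlying d) (underlying d'))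
    × (¬ ∃ λ i → i ≢ zero × ∃ λ d → ∃ λ d' → d ∈ T × d' ∈ T × head d ≡ upper i × tail d' ≡ upper i)
    × (¬ ∃ λ j → j ≢ zero × ∃ λ d → ∃ λ d' → d ∈ T × d' ∈ T × head d ≡ lower j × tail d' ≡ lower j)

  upEdge : DEdge a b → Maybe (Edge a b)
  upEdge (up i j) = just (i , j)
  upEdge (dn i j) = nothing

  downEdge : DEdge a b → Maybe (Edge a b)
  downEdge (dn i j) = just (i , j)
  downEdge (up i j) = nothing

  ends : Edge a b → List (Vertex a b)
  ends (i , j) = upper i ∷ lower j ∷ []

  spanned : Vertex a b → List (Edge a b) → Subgraph
  spanned x₀ [] = mkSub (x₀ ∷ []) []
  spanned x₀ E@(_ ∷ _) = mkSub (concatMap ends E) E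

  T↑ : List (DEdge a b) → Subgraph
  T↑ T = spanned (lower zero) (mapMaybe upEdge T)

  T↓ : List (DEdge a b) → Subgraph
  T↓ T = spanned (upper zero) (mapMaybe downEdge T)

  MeetExactlyIn : Subgraph → Subgraph → Vertex a b → Set
  MeetExactlyIn G H x = ∀ y → (y ∈ verts G × y ∈ verts H) ⇔ (y ≡ x)

-- Conditions (3) and (4) say that every vertex other than v₀, w₀ carries edges of a
-- single orientation.  So T↑ and T↓ can share only v₀ or w₀, and a walk in T that leaves
-- such a vertex along an upward (downward) edge stays upward (downward) until it reaches
-- v₀ or w₀; thus every vertex of T↑ is joined inside T↑ to v₀ or w₀.  Conditions (1) and
-- (2) force v₀w₀ to be an upward edge whenever v₀ and w₀ both carry upward edges, since
-- otherwise some v₀w_j and v_iw₀ would cross (likewise downward).  Hence T↑ and T↓ are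
-- connected and do not share both v₀ and w₀.  A walk in T from T↓ to T↑ passes through a
-- shared vertex, necessarily v₀ or w₀; the other one carries an edge of some orientation,
-- so v₀w₀ ∈ T.  Conversely, planarity of T↑ and T↓ is (1) and (2), and a vertex violating
-- (3) or (4) lies in both T↑ and T↓.
module Submission where

open import Defs
open import Data.Nat using (ℕ; suc; s≤s; z≤n; _≥_)
open import Data.Fin using (Fin; zero; suc)
open import Data.List using (List; []; _∷_; map; mapMaybe; length)
open import Data.List.Membership.Propositional using (_∈_; find)
open import Data.List.Membership.Propositional.Properties using (∈-map⁺; ∈-map⁻; ∈-concatMap⁺; ∈-concatMap⁻)
open import Data.List.Relation.Unary.Any as Any using (here; there)
open import Data.List.Relation.Unary.All as All using ()
open import Data.List.Relation.Unary.AllPairs using (_∷_)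
open import Data.List.Relation.Unary.Unique.Propositional using (Unique)
open import Data.Maybe using (Maybe)
open import Data.Product using (_×_; _,_; Σ; proj₁; proj₂)
open import Data.Sum using (_⊎_; inj₁; inj₂)
open import Data.Empty using (⊥; ⊥-elim)
open import Relation.Binary.PropositionalEquality using (_≡_; refl; sym; trans; cong; subst)
open import Relation.Nullary using (¬_; Dec; yes; no)
open import Function.Bundles using (_⇔_; mk⇔; Equivalence)

Unique-map⇒injectiveOn : ∀ {A B : Set} (f : A → B) {xs : List A} {x y : A} →
  Unique (map f xs) → x ∈ xs → y ∈ xs → f x ≡ f y → x ≡ y
Unique-map⇒injectiveOn f (_ ∷ _) (here refl) (here refl) _ = refl
Unique-map⇒injectiveOn f (fx∉ ∷ _) (here refl) (there y∈) eq = ⊥-elim (All.lookup fx∉ (∈-map⁺ f y∈) eq)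
Unique-map⇒injectiveOn f (fy∉ ∷ _) (there x∈) (here refl) eq = ⊥-elim (All.lookup fy∉ (∈-map⁺ f x∈) (sym eq))
Unique-map⇒injectiveOn f (_ ∷ u) (there x∈) (there y∈) eq = Unique-map⇒injectiveOn f u x∈ y∈ eq

data Orientation : Set where
  upward downward : Orientation

module _ {a b : ℕ} where

  Joins-sym : ∀ {e : Edge a b} {x y} → Joins e x y → Joins e y x
  Joins-sym (inj₁ (p , q)) = inj₂ (q , p)
  Joins-sym (inj₂ (p , q)) = inj₁ (q , p)

  Joins⇒∈ends : ∀ {e : Edge a b} {x y} → Joins e x y → x ∈ ends e × y ∈ ends e
  Joins⇒∈ends (inj₁ (refl , refl)) = here refl , there (here refl)
  Joins⇒∈ends (inj₂ (refl , refl)) = there (here refl) , here refl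

  _++ʷ_ : ∀ {E : List (Edge a b)} {x y z} → Walk E x y → Walk E y z → Walk E x z
  stop ++ʷ v = v
  step e m J w ++ʷ v = step e m J (w ++ʷ v)

  reverseʷ : ∀ {E : List (Edge a b)} {x y} → Walk E x y → Walk E y x
  reverseʷ stop = stop
  reverseʷ (step e m J w) = reverseʷ w ++ʷ step e m (Joins-sym J) stop

  Walk-mono : ∀ {E₁ E₂ : List (Edge a b)} → (∀ {e} → e ∈ E₁ → e ∈ E₂) →
    ∀ {x y} (w : Walk E₁ x y) → Σ (Walk E₂ x y) λ w′ → walkEdges w′ ≡ walkEdges w
  Walk-mono E₁⊆E₂ stop = stop , refl
  Walk-mono E₁⊆E₂ (step e m J w) =
    let w′ , same = Walk-mono E₁⊆E₂ w in step e (E₁⊆E₂ m) J w′ , cong (e ∷_) same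

  Acyclic-mono : ∀ {E₁ E₂ : List (Edge a b)} → (∀ {e} → e ∈ E₁ → e ∈ E₂) → Acyclic E₂ → Acyclic E₁
  Acyclic-mono E₁⊆E₂ acyclic (x , w , nonempty , distinct) =
    let w′ , same = Walk-mono E₁⊆E₂ w
    in acyclic (x , w′ , subst (λ es → length es ≥ 1) (sym same) nonempty ,
                          subst Unique (sym same) distinct)

  ∈-spanned-verts⁺ : ∀ {x₀ y : Vertex a b} {E e} → e ∈ E → y ∈ ends e → y ∈ verts (spanned x₀ E)
  ∈-spanned-verts⁺ {E = _ ∷ _} e∈ y∈ = ∈-concatMap⁺ ends (Any.map (λ { refl → y∈ }) e∈)

  ∈-spanned-verts⁻ : ∀ {x₀ y : Vertex a b} {E} → y ∈ verts (spanned x₀ E) →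
    (Σ (Edge a b) λ e → e ∈ E × y ∈ ends e) ⊎ (E ≡ [] × y ≡ x₀)
  ∈-spanned-verts⁻ {E = []} (here refl) = inj₂ (refl , refl)
  ∈-spanned-verts⁻ {E = _ ∷ _} y∈ = inj₁ (find (∈-concatMap⁻ ends y∈))

  spanned-verts-nonempty : ∀ (x₀ : Vertex a b) E → Σ (Vertex a b) λ x → x ∈ verts (spanned x₀ E)
  spanned-verts-nonempty x₀ [] = x₀ , here refl
  spanned-verts-nonempty x₀ ((i , j) ∷ E) = upper i , here refl

  spanned-edges : ∀ (x₀ : Vertex a b) E → edges (spanned x₀ E) ≡ E
  spanned-edges x₀ [] = refl
  spanned-edges x₀ (_ ∷ _) = refl

  spanned-subtree : ∀ {x₀ : Vertex a b} {E} →
    (∀ x y → x ∈ verts (spanned x₀ E) → y ∈ verts (spanned x₀ E) → Walk E x y) →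
    Acyclic E → IsSubtree (spanned x₀ E)
  spanned-subtree {E = []} = _,_
  spanned-subtree {E = _ ∷ _} = _,_

  data Special : Vertex a b → Set where
    v₀ : Special (upper zero)
    w₀ : Special (lower zero)

  special-upper : ∀ {i} → Special (upper i) → i ≡ zero
  special-upper v₀ = refl

  special-lower : ∀ {j} → Special (lower j) → j ≡ zero
  special-lower w₀ = refl

  special? : ∀ x → Dec (Special x)
  special? (upper zero) = yes v₀
  special? (upper (suc i)) = no λ ()
  special? (lower zero) = yes w₀
  special? (lower (suc j)) = no λ ()

  oriented : Orientation → Fin (suc a) → Fin (suc b) → DEdge a b
  oriented upward = up
  oriented downward = dn

  select : Orientation → DEdge a b → Maybe (Edge a b)
  select upward = upEdge
  select downward = downEdge

  base : Orientation → Vertex a b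
  base upward = lower zero
  base downward = upper zero

  base-special : ∀ o → Special (base o)
  base-special upward = w₀
  base-special downward = v₀

  ∈-select⁺ : ∀ o {T i j} → oriented o i j ∈ T → (i , j) ∈ mapMaybe (select o) T
  ∈-select⁺ upward (here refl) = here refl
  ∈-select⁺ downward (here refl) = here refl
  ∈-select⁺ upward {up _ _ ∷ _} (there p) = there (∈-select⁺ upward p)
  ∈-select⁺ upward {dn _ _ ∷ _} (there p) = ∈-select⁺ upward p
  ∈-select⁺ downward {up _ _ ∷ _} (there p) = ∈-select⁺ downward p
  ∈-select⁺ downward {dn _ _ ∷ _} (there p) = there (∈-select⁺ downward p)

  ∈-select⁻ : ∀ o {T i j} → (i , j) ∈ mapMaybe (select o) T → oriented o i j ∈ T
  ∈-select⁻ upward {up _ _ ∷ _} (here refl) = here refl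
  ∈-select⁻ upward {up _ _ ∷ _} (there p) = there (∈-select⁻ upward p)
  ∈-select⁻ upward {dn _ _ ∷ _} p = there (∈-select⁻ upward p)
  ∈-select⁻ downward {dn _ _ ∷ _} (here refl) = here refl
  ∈-select⁻ downward {dn _ _ ∷ _} (there p) = there (∈-select⁻ downward p)
  ∈-select⁻ downward {up _ _ ∷ _} p = there (∈-select⁻ downward p)

module Sides {a b : ℕ} (T : List (DEdge a b)) where

  E : List (Edge a b)
  E = map underlying T

  Edges : Orientation → List (Edge a b)
  Edges o = mapMaybe (select o) T

  Part : Orientation → Subgraph
  Part o = spanned (base o) (Edges o)

  Verts : Orientation → List (Vertex a b)
  Verts o = verts (Part o)

  HasEdge : Orientation → Vertex a b → Set
  HasEdge o (upper i) = Σ (Fin (suc b)) λ j → oriented o i j ∈ T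
  HasEdge o (lower j) = Σ (Fin (suc a)) λ i → oriented o i j ∈ T

  orientation : ∀ {i j} → (i , j) ∈ E → Σ Orientation λ o → oriented o i j ∈ T
  orientation e∈ with ∈-map⁻ underlying e∈
  ... | up _ _ , p , refl = upward , p
  ... | dn _ _ , p , refl = downward , p

  Edges⊆E : ∀ o {e} → e ∈ Edges o → e ∈ E
  Edges⊆E upward e∈ = ∈-map⁺ underlying (∈-select⁻ upward e∈)
  Edges⊆E downward e∈ = ∈-map⁺ underlying (∈-select⁻ downward e∈)

  HasEdge-joins : ∀ {o i j x y} → oriented o i j ∈ T → Joins (i , j) x y → HasEdge o x × HasEdge o y
  HasEdge-joins p (inj₁ (refl , refl)) = (_ , p) , (_ , p)
  HasEdge-joins p (inj₂ (refl , refl)) = (_ , p) , (_ , p)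

  ∈Verts⁺ : ∀ {o i j x} → oriented o i j ∈ T → x ∈ ends (i , j) → x ∈ Verts o
  ∈Verts⁺ {o} p x∈ = ∈-spanned-verts⁺ {E = Edges o} (∈-select⁺ o p) x∈

  ∈Verts⁻ : ∀ {o x} → x ∈ Verts o → HasEdge o x ⊎ (Edges o ≡ [] × x ≡ base o)
  ∈Verts⁻ {o} x∈ with ∈-spanned-verts⁻ {E = Edges o} x∈
  ... | inj₂ empty = inj₂ empty
  ... | inj₁ ((i , j) , e∈ , here refl) = inj₁ (j , ∈-select⁻ o e∈)
  ... | inj₁ ((i , j) , e∈ , there (here refl)) = inj₁ (i , ∈-select⁻ o e∈)

  ∈Verts⇒HasEdge : ∀ {o x} → ¬ Special x → x ∈ Verts o → HasEdge o x
  ∈Verts⇒HasEdge {o} ¬sx x∈ with ∈Verts⁻ x∈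
  ... | inj₁ h = h
  ... | inj₂ (_ , refl) = ⊥-elim (¬sx (base-special o))

  Edges-nonempty : ∀ {o i j} → oriented o i j ∈ T → ¬ Edges o ≡ []
  Edges-nonempty {o} p empty with subst (_ ∈_) empty (∈-select⁺ o p)
  ... | ()

  IsPlanar : Orientation → Set
  IsPlanar o = ∀ {i j i′ j′} → oriented o i j ∈ T → oriented o i′ j′ ∈ T → ¬ Cross (i , j) (i′ , j′)

  Planar⇒IsPlanar : ∀ o → Planar (Part o) → IsPlanar o
  Planar⇒IsPlanar o planar p q =
    planar _ _ (subst (_ ∈_) (sym same) (∈-select⁺ o p)) (subst (_ ∈_) (sym same) (∈-select⁺ o q))
    where
    same : edges (Part o) ≡ Edges o
    same = spanned-edges (base o) (Edges o)

  IsPlanar⇒Planar : ∀ o → IsPlanar o → Planar (Part o)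
  IsPlanar⇒Planar o noCross e e′ e∈ e′∈ =
    noCross (∈-select⁻ o (subst (_ ∈_) same e∈)) (∈-select⁻ o (subst (_ ∈_) same e′∈))
    where
    same : edges (Part o) ≡ Edges o
    same = spanned-edges (base o) (Edges o)

  meet⇒special : MeetExactlyIn (T↑ T) (T↓ T) (upper zero) ⊎ MeetExactlyIn (T↑ T) (T↓ T) (lower zero) →
    ∀ {y} → y ∈ Verts upward → y ∈ Verts downward → Special y
  meet⇒special (inj₁ meets) y∈↑ y∈↓ with Equivalence.to (meets _) (y∈↑ , y∈↓)
  ... | refl = v₀
  meet⇒special (inj₂ meets) y∈↑ y∈↓ with Equivalence.to (meets _) (y∈↑ , y∈↓)
  ... | refl = w₀

  admissible : IsPlanar upward → IsPlanar downward →
    (∀ {y} → y ∈ Verts upward → y ∈ Verts downward → Special y) → Admissible T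
  admissible planar↑ planar↓ shared⇒special =
      (λ { (_ , _ , p , q , (_ , _ , refl) , (_ , _ , refl) , cross) → planar↓ p q cross })
    , (λ { (_ , _ , p , q , (_ , _ , refl) , (_ , _ , refl) , cross) → planar↑ p q cross })
    , (λ { (i , i≢0 , up .i _ , dn .i _ , p , q , refl , refl) →
             i≢0 (special-upper (shared⇒special (∈Verts⁺ p (here refl)) (∈Verts⁺ q (here refl))))
         ; (_ , _ , dn _ _ , _ , _ , _ , () , _)
         ; (_ , _ , up _ _ , up _ _ , _ , _ , _ , ()) })
    , (λ { (j , j≢0 , dn _ .j , up _ .j , p , q , refl , refl) →
             j≢0 (special-lower (shared⇒special (∈Verts⁺ q (there (here refl)))
                                                (∈Verts⁺ p (there (here refl)))))
         ; (_ , _ , up _ _ , _ , _ , _ , () , _)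
         ; (_ , _ , dn _ _ , dn _ _ , _ , _ , _ , ()) })

module Admissible⇒ {a b : ℕ} {T : List (DEdge a b)} (tree : IsDirectedSpanningTree T) (adm : Admissible T) where

  open Sides T

  spanning : ∀ x y → Walk E x y
  spanning = proj₁ (proj₂ tree)

  not-both-orientations : ∀ {i j} → oriented upward i j ∈ T → oriented downward i j ∈ T → ⊥
  not-both-orientations p q with Unique-map⇒injectiveOn underlying (proj₁ tree) p q refl
  ... | ()

  planar : ∀ o → IsPlanar o
  planar upward p q cross = proj₁ (proj₂ adm) (_ , _ , p , q , (_ , _ , refl) , (_ , _ , refl) , cross)
  planar downward p q cross = proj₁ adm (_ , _ , p , q , (_ , _ , refl) , (_ , _ , refl) , cross)

  single-orientation : ∀ {x} → ¬ Special x → HasEdge upward x → HasEdge downward x → ⊥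
  single-orientation {upper i} ¬sx (_ , p) (_ , q) =
    proj₁ (proj₂ (proj₂ adm)) (i , (λ { refl → ¬sx v₀ }) , _ , _ , p , q , refl , refl)
  single-orientation {lower j} ¬sx (_ , p) (_ , q) =
    proj₂ (proj₂ (proj₂ adm)) (j , (λ { refl → ¬sx w₀ }) , _ , _ , q , p , refl , refl)

  keeps-orientation : ∀ {o i j x y} → ¬ Special x → HasEdge o x → (i , j) ∈ E → Joins (i , j) x y →
    oriented o i j ∈ T
  keeps-orientation {o} ¬sx h e∈ J with o | orientation e∈
  ... | upward | upward , p = p
  ... | downward | downward , p = p
  ... | upward | downward , p = ⊥-elim (single-orientation ¬sx h (proj₁ (HasEdge-joins p J)))
  ... | downward | upward , p = ⊥-elim (single-orientation ¬sx (proj₁ (HasEdge-joins p J)) h)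

  -- If j, i ≠ 0 the edges v₀w_j and v_iw₀ cross.
  corner : ∀ {o i j} → oriented o zero j ∈ T → oriented o i zero ∈ T → oriented o zero zero ∈ T
  corner {j = zero} p _ = p
  corner {i = zero} _ q = q
  corner {o} {suc _} {suc _} p q = ⊥-elim (planar o p q (inj₁ (s≤s z≤n , s≤s z≤n)))

  specials-joined : ∀ {o} → upper zero ∈ Verts o → lower zero ∈ Verts o → oriented o zero zero ∈ T
  specials-joined v∈ w∈ with ∈Verts⁻ v∈ | ∈Verts⁻ w∈
  ... | inj₁ (_ , p) | inj₁ (_ , q) = corner p q
  ... | inj₁ (_ , p) | inj₂ (empty , _) = ⊥-elim (Edges-nonempty p empty)
  ... | inj₂ (empty , _) | inj₁ (_ , q) = ⊥-elim (Edges-nonempty q empty)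
  ... | inj₂ (_ , v≡base) | inj₂ (_ , w≡base) with trans v≡base (sym w≡base)
  ...   | ()

  reach-special : ∀ o {x z} → Walk E x z → Special z → ¬ Special x → HasEdge o x →
    Σ (Vertex a b) λ s → Special s × s ∈ Verts o × Walk (Edges o) x s
  reach-special o stop sz ¬sx _ = ⊥-elim (¬sx sz)
  reach-special o (step {y = y} (i , j) e∈ J w) sz ¬sx h
    with keeps-orientation ¬sx h e∈ J | special? y
  ... | p | yes sy = y , sy , ∈Verts⁺ p (proj₂ (Joins⇒∈ends J)) , step (i , j) (∈-select⁺ o p) J stop
  ... | p | no ¬sy =
    let s , ss , s∈ , w′ = reach-special o w sz ¬sy (proj₂ (HasEdge-joins p J))
    in s , ss , s∈ , step (i , j) (∈-select⁺ o p) J w′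

  to-special : ∀ o {x} → x ∈ Verts o → Σ (Vertex a b) λ s → Special s × s ∈ Verts o × Walk (Edges o) x s
  to-special o {x} x∈ with special? x
  ... | yes sx = x , sx , x∈ , stop
  ... | no ¬sx = reach-special o (spanning x (upper zero)) v₀ ¬sx (∈Verts⇒HasEdge ¬sx x∈)

  between-specials : ∀ o {s t} → Special s → Special t → s ∈ Verts o → t ∈ Verts o → Walk (Edges o) s t
  between-specials o v₀ v₀ _ _ = stop
  between-specials o w₀ w₀ _ _ = stop
  between-specials o v₀ w₀ v∈ w∈ =
    step (zero , zero) (∈-select⁺ o (specials-joined v∈ w∈)) (inj₁ (refl , refl)) stop
  between-specials o w₀ v₀ w∈ v∈ = reverseʷ (between-specials o v₀ w₀ v∈ w∈)

  subtree : ∀ o → IsSubtree (Part o)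
  subtree o = spanned-subtree connected (Acyclic-mono (Edges⊆E o) (proj₂ (proj₂ tree)))
    where
    connected : ∀ x y → x ∈ Verts o → y ∈ Verts o → Walk (Edges o) x y
    connected x y x∈ y∈ =
      let s , ss , s∈ , x→s = to-special o x∈
          t , st , t∈ , y→t = to-special o y∈
      in x→s ++ʷ (between-specials o ss st s∈ t∈ ++ʷ reverseʷ y→t)

  shared⇒special : ∀ {y} → y ∈ Verts upward → y ∈ Verts downward → Special y
  shared⇒special {y} y∈↑ y∈↓ with special? y
  ... | yes sy = sy
  ... | no ¬sy = ⊥-elim (single-orientation ¬sy (∈Verts⇒HasEdge ¬sy y∈↑) (∈Verts⇒HasEdge ¬sy y∈↓))

  crosses-over : ∀ {x z} → Walk E x z → x ∈ Verts downward → z ∈ Verts upward →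
    Σ (Vertex a b) λ y → y ∈ Verts upward × y ∈ Verts downward
  crosses-over {x} stop x∈↓ x∈↑ = x , x∈↑ , x∈↓
  crosses-over (step e e∈ J w) x∈↓ z∈↑ with orientation e∈
  ... | upward , p = _ , ∈Verts⁺ p (proj₁ (Joins⇒∈ends J)) , x∈↓
  ... | downward , p = crosses-over w (∈Verts⁺ p (proj₂ (Joins⇒∈ends J))) z∈↑

  shared-special : Σ (Vertex a b) λ s → Special s × s ∈ Verts upward × s ∈ Verts downward
  shared-special =
    let x , x∈↓ = spanned-verts-nonempty (base downward) (Edges downward)
        z , z∈↑ = spanned-verts-nonempty (base upward) (Edges upward)
        s , s∈↑ , s∈↓ = crosses-over (spanning x z) x∈↓ z∈↑
    in s , shared⇒special s∈↑ s∈↓ , s∈↑ , s∈↓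

  shared-unique : ∀ {s t} → Special s → Special t →
    s ∈ Verts upward → s ∈ Verts downward → t ∈ Verts upward → t ∈ Verts downward → s ≡ t
  shared-unique v₀ v₀ _ _ _ _ = refl
  shared-unique w₀ w₀ _ _ _ _ = refl
  shared-unique v₀ w₀ v∈↑ v∈↓ w∈↑ w∈↓ =
    ⊥-elim (not-both-orientations (specials-joined v∈↑ w∈↑) (specials-joined v∈↓ w∈↓))
  shared-unique w₀ v₀ w∈↑ w∈↓ v∈↑ v∈↓ =
    ⊥-elim (not-both-orientations (specials-joined v∈↑ w∈↑) (specials-joined v∈↓ w∈↓))

  meets-in : ∀ {s} → Special s → s ∈ Verts upward → s ∈ Verts downward → MeetExactlyIn (T↑ T) (T↓ T) s
  meets-in ss s∈↑ s∈↓ y =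
    mk⇔ (λ (y∈↑ , y∈↓) → shared-unique (shared⇒special y∈↑ y∈↓) ss y∈↑ y∈↓ s∈↑ s∈↓)
        (λ { refl → s∈↑ , s∈↓ })

  meet : MeetExactlyIn (T↑ T) (T↓ T) (upper zero) ⊎ MeetExactlyIn (T↑ T) (T↓ T) (lower zero)
  meet with shared-special
  ... | _ , v₀ , v∈↑ , v∈↓ = inj₁ (meets-in v₀ v∈↑ v∈↓)
  ... | _ , w₀ , w∈↑ , w∈↓ = inj₂ (meets-in w₀ w∈↑ w∈↓)

  leaves : ∀ {x y} → Walk E x y → ¬ x ≡ y → Σ Orientation λ o → x ∈ Verts o
  leaves stop x≢x = ⊥-elim (x≢x refl)
  leaves (step e e∈ J _) _ with orientation e∈
  ... | o , p = o , ∈Verts⁺ p (proj₁ (Joins⇒∈ends J))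

  covered : ∀ x → Σ Orientation λ o → x ∈ Verts o
  covered (upper i) = leaves (spanning (upper i) (lower zero)) λ ()
  covered (lower j) = leaves (spanning (lower j) (upper zero)) λ ()

  corner-edge : dn zero zero ∈ T ⊎ up zero zero ∈ T
  corner-edge with shared-special
  ... | _ , v₀ , v∈↑ , v∈↓ with covered (lower zero)
  ...   | upward , w∈ = inj₂ (specials-joined v∈↑ w∈)
  ...   | downward , w∈ = inj₁ (specials-joined v∈↓ w∈)
  corner-edge | _ , w₀ , w∈↑ , w∈↓ with covered (upper zero)
  ...   | upward , v∈ = inj₂ (specials-joined v∈ w∈↑)
  ...   | downward , v∈ = inj₁ (specials-joined v∈ w∈↓)

proposition4p3 : (a b : ℕ) (T : List (DEdge a b)) → IsDirectedSpanningTree T →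
    Admissible T ⇔
      ((dn zero zero ∈ T ⊎ up zero zero ∈ T)
       × (Planar (T↑ T) × IsSubtree (T↑ T)) × (Planar (T↓ T) × IsSubtree (T↓ T))
       × (MeetExactlyIn (T↑ T) (T↓ T) (upper zero) ⊎ MeetExactlyIn (T↑ T) (T↓ T) (lower zero)))
proposition4p3 a b T tree = mk⇔
  (λ adm → let open Admissible⇒ tree adm in
      corner-edge
    , (IsPlanar⇒Planar upward (planar upward) , subtree upward)
    , (IsPlanar⇒Planar downward (planar downward) , subtree downward)
    , meet)
  (λ (_ , (planar↑ , _) , (planar↓ , _) , meets) →
    admissible (Planar⇒IsPlanar upward planar↑) (Planar⇒IsPlanar downward planar↓) (meet⇒special meets))
  where open Sides T
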